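{- Let $n\geq 2$ and $p\in[\pm n]$. If $\pi_1,\pi_2$ are distinct vertices of $BP_{n-1}(p)$ with $d(\pi_1,\pi_2)\leq 2$, then $\pi_1 r_n$ and $\pi_2 r_n$ belong to distinct copies $BP_{n-1}(q)$, $BP_{n-1}(q')$ ($q\neq q'$), i.e. the last window entries of $\pi_1 r_n$ and $\pi_2 r_n$ differ.
   Context: Signed permutations of $[\pm n]=\{ -n,\dots,-1,1,\dots,n\}$ are bijections $w$ with $w(-i)=-w(i)$, written in window notation $[w(1)\cdots w(n)]$, with $\underline{i}=-i$; $B_n$ is their group. For $1\leq i\leq n$, $w r_i=[\underline{w(i)}\cdots\underline{w(1)}\,w(i+1)\cdots w(n)]$. The burnt pancake graph $BP_n$ has vertex set $B_n$ and edges $\{w,wr_i\}$ for $w\in B_n$, $1\leq i\leq n$. For $q\in[\pm n]$, $BP_{n-1}(q)$ is the subgraph of $BP_n$ induced by the signed permutations with last window entry $q$. $d(\pi,\tau)$ is the length of a shortest $\pi$–$\tau$ path in $BP_n$. -}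

module Defs where

open import Data.Nat using (ℕ; zero; suc; _≤_; _+_)
open import Data.Integer using (ℤ; -_; ∣_∣)
open import Data.List using (List; []; _∷_; map; reverse; take; drop; _++_; upTo; length; last)
open import Data.List.Relation.Binary.Permutation.Propositional using (_↭_)
open import Data.Product using (Σ; _×_; ∃)
open import Relation.Binary.PropositionalEquality using (_≡_)

-- A signed permutation of [±n] is represented by its window
-- [w(1) ⋯ w(n)] as a list of integers (negative integers = barred entries).
-- It is a signed permutation iff the absolute values of the window
-- entries are a permutation of 1,…,n (then w(-i) := -w(i) extends it
-- to a bijection of [±n] commuting with negation, and conversely).
IsSignedPerm : ℕ → List ℤ → Set
IsSignedPerm n w = map ∣_∣ w ↭ map suc (upTo n)

r : ℕ → List ℤ → List ℤ
r i w = map -_ (reverse (take i w)) ++ drop i w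

data Walk (n : ℕ) : List ℤ → List ℤ → ℕ → Set where
  here : ∀ {w} → Walk n w w 0
  step : ∀ {w v k} (i : ℕ) → 1 ≤ i → i ≤ n →
         Walk n (r i w) v k → Walk n w v (suc k)

Dist≤ : ℕ → List ℤ → List ℤ → ℕ → Set
Dist≤ n π τ k = ∃ λ l → l ≤ k × Walk n π τ l

module Submission where

-- Lemma 4.5.  In the burnt pancake graph the last window entry of  π r_n
-- is  -π(1) , so the statement says: two distinct signed permutations with
-- the same first entry are at distance at least 3.  Two facts about a
-- signed permutation  w  give this, with  w r_i  starting with  -w(i) :
--   * a single flip always moves the first entry:  -w(i) = w(1)  forces
--     |w(i)| = |w(1)| , hence  i = 1 , and then  w(1) = -w(1) = 0 ;
--   * two flips  σ r_i , σ r_j  with the same first entry coincide: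
--     -σ(i) = -σ(j)  forces  i = j  since entries have distinct moduli.
-- A walk  π₁ → π₁ r_i → π₁ r_i r_j = π₂  with  π₂(1) = π₁(1) = (π₁ r_i) r_i (1)
-- thus has  i = j , so  π₂ = π₁  because prefix reversals are involutions.

open import Defs
open import Data.Nat using (ℕ; zero; suc; _≤_; _<_; s≤s)
open import Data.Nat.Properties using (m≤n⇒m⊓n≡m; ≤-reflexive; ≤-trans; suc-injective)
open import Data.Integer using (ℤ; +_; -[1+_]; -_; ∣_∣)
open import Data.Integer.Properties using (neg-involutive; neg-injective; ∣-i∣≡∣i∣)
open import Data.List using (List; []; _∷_; _∷ʳ_; [_]; map; reverse; take; drop; _++_; upTo; length; last)
open import Data.List.Properties
  using (map-++; map-∘; map-cong; map-id; length-map; length-reverse; length-take;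
         length-upTo; reverse-map; reverse-involutive; unfold-reverse;
         take-all; drop-all; take++drop≡id; ++-identityʳ)
open import Data.List.Relation.Binary.Permutation.Propositional
  using (_↭_; ↭-sym; ↭-trans; ↭⇒↭ₛ; module PermutationReasoning)
open import Data.List.Relation.Binary.Permutation.Propositional.Properties
  using (↭-length; ↭-reverse; ++⁺ʳ; map⁺; All-resp-↭)
import Data.List.Relation.Binary.Permutation.Setoid.Properties as SetoidPerm
open import Data.List.Relation.Unary.All using (All; []; _∷_)
open import Data.List.Relation.Unary.AllPairs using (_∷_)
open import Data.List.Relation.Unary.Unique.Propositional using (Unique)
import Data.List.Relation.Unary.Unique.Propositional.Properties as Unique
open import Data.Maybe using (Maybe; just; nothing)
open import Data.Maybe.Properties using (just-injective; map-injective)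
import Data.Maybe as Maybe
open import Data.Product using (∃; _,_)
open import Data.Empty using (⊥; ⊥-elim)
open import Function using (_∘′_)
open import Relation.Binary.PropositionalEquality
  using (_≡_; _≢_; refl; sym; trans; cong; cong₂; subst; setoid; module ≡-Reasoning)

entry : {A : Set} → ℕ → List A → Maybe A
entry k       []       = nothing
entry zero    (x ∷ xs) = just x
entry (suc k) (x ∷ xs) = entry k xs

entry-defined : {A : Set} (k : ℕ) (xs : List A) → k < length xs → ∃ λ x → entry k xs ≡ just x
entry-defined zero    (x ∷ xs) _         = x , refl
entry-defined (suc k) (x ∷ xs) (s≤s k<) = entry-defined k xs k<

entry-map : {A B : Set} (f : A → B) (k : ℕ) (xs : List A) →
            entry k (map f xs) ≡ Maybe.map f (entry k xs)
entry-map f k       []       = refl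
entry-map f zero    (x ∷ xs) = refl
entry-map f (suc k) (x ∷ xs) = entry-map f k xs

All-entry : {A : Set} {P : A → Set} (k : ℕ) (xs : List A) {x : A} →
            All P xs → entry k xs ≡ just x → P x
All-entry zero    (x ∷ xs) (px ∷ _)  refl = px
All-entry (suc k) (x ∷ xs) (_ ∷ pxs) e    = All-entry k xs pxs e

Unique-entry-injective : {A : Set} (a b : ℕ) (xs : List A) {x : A} → Unique xs →
                         entry a xs ≡ just x → entry b xs ≡ just x → a ≡ b
Unique-entry-injective zero    zero    (y ∷ xs) _          _    _    = refl
Unique-entry-injective zero    (suc b) (y ∷ xs) (y∉ ∷ _)   refl e    = ⊥-elim (All-entry b xs y∉ e refl)
Unique-entry-injective (suc a) zero    (y ∷ xs) (y∉ ∷ _)   e    refl = ⊥-elim (All-entry a xs y∉ e refl)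
Unique-entry-injective (suc a) (suc b) (y ∷ xs) (_ ∷ uxs)  ea   eb   =
  cong suc (Unique-entry-injective a b xs uxs ea eb)

entry₀-++ : {A : Set} (xs ys : List A) {x : A} → entry 0 xs ≡ just x → entry 0 (xs ++ ys) ≡ just x
entry₀-++ (y ∷ xs) ys e = e

last-∷ʳ : {A : Set} (xs : List A) (x : A) → last (xs ∷ʳ x) ≡ just x
last-∷ʳ []           x = refl
last-∷ʳ (y ∷ [])     x = refl
last-∷ʳ (y ∷ z ∷ xs) x = last-∷ʳ (z ∷ xs) x

entry₀-reverse : {A : Set} (xs : List A) {x : A} → last xs ≡ just x → entry 0 (reverse xs) ≡ just x
entry₀-reverse (y ∷ [])     refl = refl
entry₀-reverse (y ∷ z ∷ xs) e    =
  trans (cong (entry 0) (unfold-reverse y (z ∷ xs)))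
        (entry₀-++ (reverse (z ∷ xs)) [ y ] (entry₀-reverse (z ∷ xs) e))

last-reverse : {A : Set} (xs : List A) → last (reverse xs) ≡ entry 0 xs
last-reverse []       = refl
last-reverse (x ∷ xs) rewrite unfold-reverse x xs = last-∷ʳ (reverse xs) x

last-map : {A B : Set} (f : A → B) (xs : List A) → last (map f xs) ≡ Maybe.map f (last xs)
last-map f []           = refl
last-map f (x ∷ [])     = refl
last-map f (x ∷ y ∷ xs) = last-map f (y ∷ xs)

last-take : {A : Set} (k : ℕ) (xs : List A) {x : A} → entry k xs ≡ just x → last (take (suc k) xs) ≡ just x
last-take zero    (y ∷ xs)     refl = refl
last-take (suc k) (y ∷ z ∷ xs) e    = last-take k (z ∷ xs) e

flipped : List ℤ → List ℤ
flipped xs = map -_ (reverse xs)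

entry₀-r : (k : ℕ) (w : List ℤ) {x : ℤ} → entry k w ≡ just x → entry 0 (r (suc k) w) ≡ just (- x)
entry₀-r k w {x} e = entry₀-++ (flipped (take (suc k) w)) (drop (suc k) w) front-of-block
  where
  front-of-block : entry 0 (flipped (take (suc k) w)) ≡ just (- x)
  front-of-block = trans (entry-map -_ 0 (reverse (take (suc k) w)))
                         (cong (Maybe.map -_) (entry₀-reverse (take (suc k) w) (last-take k w e)))

last-r-full : (n : ℕ) (w : List ℤ) → length w ≡ n → last (r n w) ≡ Maybe.map -_ (entry 0 w)
last-r-full n w refl = begin
  last (flipped (take n w) ++ drop n w) ≡⟨ cong₂ (λ t d → last (flipped t ++ d))
                                                  (take-all n w (≤-reflexive refl))
                                                  (drop-all n w (≤-reflexive refl)) ⟩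
  last (flipped w ++ [])                ≡⟨ cong last (++-identityʳ (flipped w)) ⟩
  last (map -_ (reverse w))             ≡⟨ last-map -_ (reverse w) ⟩
  Maybe.map -_ (last (reverse w))       ≡⟨ cong (Maybe.map -_) (last-reverse w) ⟩
  Maybe.map -_ (entry 0 w)              ∎
  where open ≡-Reasoning

length-flipped : (xs : List ℤ) → length (flipped xs) ≡ length xs
length-flipped xs = trans (length-map -_ (reverse xs)) (length-reverse xs)

flipped-involutive : (xs : List ℤ) → flipped (flipped xs) ≡ xs
flipped-involutive xs = begin
  map -_ (reverse (map -_ (reverse xs))) ≡⟨ cong (map -_) (sym (reverse-map -_ (reverse xs))) ⟩
  map -_ (map -_ (reverse (reverse xs))) ≡⟨ sym (map-∘ (reverse (reverse xs))) ⟩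
  map (-_ ∘′ -_) (reverse (reverse xs))  ≡⟨ map-cong neg-involutive (reverse (reverse xs)) ⟩
  map (λ x → x) (reverse (reverse xs))   ≡⟨ map-id (reverse (reverse xs)) ⟩
  reverse (reverse xs)                   ≡⟨ reverse-involutive xs ⟩
  xs                                     ∎
  where open ≡-Reasoning

take-prefix : {A : Set} {i : ℕ} (xs ys : List A) → length xs ≡ i → take i (xs ++ ys) ≡ xs
take-prefix []       ys refl = refl
take-prefix (x ∷ xs) ys refl = cong (x ∷_) (take-prefix xs ys refl)

drop-prefix : {A : Set} {i : ℕ} (xs ys : List A) → length xs ≡ i → drop i (xs ++ ys) ≡ ys
drop-prefix []       ys refl = refl
drop-prefix (x ∷ xs) ys refl = drop-prefix xs ys refl

r-involutive : (i : ℕ) (w : List ℤ) → i ≤ length w → r i (r i w) ≡ w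
r-involutive i w i≤ = begin
  flipped (take i (block ++ rest)) ++ drop i (block ++ rest)
    ≡⟨ cong₂ (λ t d → flipped t ++ d) (take-prefix block rest block-length)
                                      (drop-prefix block rest block-length) ⟩
  flipped block ++ rest ≡⟨ cong (_++ rest) (flipped-involutive (take i w)) ⟩
  take i w ++ rest      ≡⟨ take++drop≡id i w ⟩
  w                     ∎
  where
  open ≡-Reasoning
  block = flipped (take i w)
  rest  = drop i w
  block-length : length block ≡ i
  block-length = trans (length-flipped (take i w))
                       (trans (length-take i w) (m≤n⇒m⊓n≡m i≤))

abs-r : (i : ℕ) (w : List ℤ) → map ∣_∣ (r i w) ↭ map ∣_∣ w
abs-r i w = begin
  map ∣_∣ (flipped (take i w) ++ drop i w)
    ≡⟨ map-++ ∣_∣ (flipped (take i w)) (drop i w) ⟩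
  map ∣_∣ (map -_ (reverse (take i w))) ++ map ∣_∣ (drop i w)
    ≡⟨ cong (_++ map ∣_∣ (drop i w)) (abs-negate (reverse (take i w))) ⟩
  map ∣_∣ (reverse (take i w)) ++ map ∣_∣ (drop i w)
    ≡⟨ sym (map-++ ∣_∣ (reverse (take i w)) (drop i w)) ⟩
  map ∣_∣ (reverse (take i w) ++ drop i w)
    ↭⟨ map⁺ ∣_∣ (++⁺ʳ (drop i w) (↭-reverse (take i w))) ⟩
  map ∣_∣ (take i w ++ drop i w)
    ≡⟨ cong (map ∣_∣) (take++drop≡id i w) ⟩
  map ∣_∣ w ∎
  where
  open PermutationReasoning
  abs-negate : (xs : List ℤ) → map ∣_∣ (map -_ xs) ≡ map ∣_∣ xs
  abs-negate xs = trans (sym (map-∘ xs)) (map-cong ∣-i∣≡∣i∣ xs)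

SignedPerm-length : {n : ℕ} {w : List ℤ} → IsSignedPerm n w → length w ≡ n
SignedPerm-length {n} {w} sp = begin
  length w                  ≡⟨ sym (length-map ∣_∣ w) ⟩
  length (map ∣_∣ w)        ≡⟨ ↭-length sp ⟩
  length (map suc (upTo n)) ≡⟨ length-map suc (upTo n) ⟩
  length (upTo n)           ≡⟨ length-upTo n ⟩
  n                         ∎
  where open ≡-Reasoning

SignedPerm-r : {n : ℕ} (i : ℕ) {w : List ℤ} → IsSignedPerm n w → IsSignedPerm n (r i w)
SignedPerm-r i {w} sp = ↭-trans (abs-r i w) sp

SignedPerm-abs-injective : {n : ℕ} {w : List ℤ} (a b : ℕ) {x y : ℤ} → IsSignedPerm n w →
                           entry a w ≡ just x → entry b w ≡ just y → ∣ x ∣ ≡ ∣ y ∣ → a ≡ b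
SignedPerm-abs-injective {n} {w} a b {x} {y} sp ea eb ∣x∣≡∣y∣ =
  Unique-entry-injective a b (map ∣_∣ w) moduli-unique
    (trans (entry-map ∣_∣ a w) (cong (Maybe.map ∣_∣) ea))
    (trans (entry-map ∣_∣ b w) (trans (cong (Maybe.map ∣_∣) eb) (cong just (sym ∣x∣≡∣y∣))))
  where
  moduli-unique : Unique (map ∣_∣ w)
  moduli-unique = SetoidPerm.Unique-resp-↭ (setoid ℕ) (↭⇒↭ₛ (↭-sym sp))
                    (Unique.map⁺ suc-injective (Unique.upTo⁺ n))

SignedPerm-nonzero : {n : ℕ} {w : List ℤ} (a : ℕ) {x : ℤ} → IsSignedPerm n w →
                     entry a w ≡ just x → ∣ x ∣ ≢ 0
SignedPerm-nonzero {n} {w} a sp ea =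
  All-entry a (map ∣_∣ w) (All-resp-↭ (↭-sym sp) (positive (upTo n)))
    (trans (entry-map ∣_∣ a w) (cong (Maybe.map ∣_∣) ea))
  where
  positive : (ks : List ℕ) → All (λ m → m ≢ 0) (map suc ks)
  positive []       = []
  positive (k ∷ ks) = (λ ()) ∷ positive ks

self-negative⇒zero : (x : ℤ) → - x ≡ x → ∣ x ∣ ≡ 0
self-negative⇒zero (+ zero)    _  = refl
self-negative⇒zero (+ (suc m)) ()
self-negative⇒zero -[1+ m ]    ()

flip-moves-front : {n : ℕ} {w : List ℤ} (k : ℕ) → IsSignedPerm n w → k < n →
                   entry 0 (r (suc k) w) ≢ entry 0 w
flip-moves-front {n} {w} k sp k<n same
  with entry-defined k w (≤-trans k<n (≤-reflexive (sym (SignedPerm-length sp))))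
... | x , ek = SignedPerm-nonzero 0 sp front≡x (self-negative⇒zero x (just-injective x-front))
  where
  front≡-x : entry 0 w ≡ just (- x)
  front≡-x = trans (sym same) (entry₀-r k w ek)
  k≡0 : k ≡ 0
  k≡0 = SignedPerm-abs-injective k 0 sp ek front≡-x (sym (∣-i∣≡∣i∣ x))
  front≡x : entry 0 w ≡ just x
  front≡x = subst (λ m → entry m w ≡ just x) k≡0 ek
  x-front : just (- x) ≡ just x
  x-front = trans (sym front≡-x) front≡x

front-determines-flip : {n : ℕ} {σ : List ℤ} (i j : ℕ) → IsSignedPerm n σ → i < n → j < n →
                        entry 0 (r (suc i) σ) ≡ entry 0 (r (suc j) σ) → i ≡ j
front-determines-flip {n} {σ} i j sp i<n j<n same
  with entry-defined i σ (≤-trans i<n within) | entry-defined j σ (≤-trans j<n within)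
  where within = ≤-reflexive (sym (SignedPerm-length sp))
... | x , ei | y , ej = SignedPerm-abs-injective i j sp ei ej (cong ∣_∣ x≡y)
  where
  x≡y : x ≡ y
  x≡y = neg-injective (just-injective
          (trans (sym (entry₀-r i σ ei)) (trans same (entry₀-r j σ ej))))

front-preserving-flips-cancel : {n : ℕ} {π : List ℤ} (i j : ℕ) → IsSignedPerm n π → i < n → j < n →
                                entry 0 π ≡ entry 0 (r (suc j) (r (suc i) π)) →
                                r (suc j) (r (suc i) π) ≡ π
front-preserving-flips-cancel {n} {π} i j sp i<n j<n fronts = begin
  r (suc j) σ ≡⟨ cong (λ m → r (suc m) σ) (sym i≡j) ⟩
  r (suc i) σ ≡⟨ back-to-π ⟩
  π           ∎
  where
  open ≡-Reasoning
  σ = r (suc i) π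
  back-to-π : r (suc i) σ ≡ π
  back-to-π = r-involutive (suc i) π (≤-trans i<n (≤-reflexive (sym (SignedPerm-length sp))))
  i≡j : i ≡ j
  i≡j = front-determines-flip i j (SignedPerm-r (suc i) sp) i<n j<n
          (trans (cong (entry 0) back-to-π) fronts)

equal-fronts-far-apart : {n l : ℕ} {π₁ π₂ : List ℤ} → IsSignedPerm n π₁ → π₁ ≢ π₂ →
                         entry 0 π₁ ≡ entry 0 π₂ → Walk n π₁ π₂ l → l ≤ 2 → ⊥
equal-fronts-far-apart sp π₁≢π₂ fronts here _ = π₁≢π₂ refl
equal-fronts-far-apart sp π₁≢π₂ fronts (step (suc k) _ k<n here) _ =
  flip-moves-front k sp k<n (sym fronts)
equal-fronts-far-apart sp π₁≢π₂ fronts (step (suc i) _ i<n (step (suc j) _ j<n here)) _ =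
  π₁≢π₂ (sym (front-preserving-flips-cancel i j sp i<n j<n fronts))
equal-fronts-far-apart sp π₁≢π₂ fronts (step zero () _ _) _
equal-fronts-far-apart sp π₁≢π₂ fronts (step _ _ _ (step zero () _ _)) _
equal-fronts-far-apart sp π₁≢π₂ fronts (step _ _ _ (step _ _ _ (step _ _ _ _))) (s≤s (s≤s ()))

-- Lemma 4.5: vertices at distance ≤ 2 inside  BP_{n-1}(p)  are sent by  r_n
-- into different copies, since  last (π r_n) = -π(1) .
lemma4p5 : (n : ℕ) → 2 ≤ n → (p : ℤ) → (π₁ π₂ : List ℤ) →
    IsSignedPerm n π₁ → IsSignedPerm n π₂ →
    last π₁ ≡ just p → last π₂ ≡ just p →
    π₁ ≢ π₂ → Dist≤ n π₁ π₂ 2 →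
    last (r n π₁) ≢ last (r n π₂)
lemma4p5 n _ _ π₁ π₂ sp₁ sp₂ _ _ π₁≢π₂ (l , l≤2 , walk) same-last =
  equal-fronts-far-apart sp₁ π₁≢π₂ fronts walk l≤2
  where
  fronts : entry 0 π₁ ≡ entry 0 π₂
  fronts = map-injective neg-injective
             (trans (sym (last-r-full n π₁ (SignedPerm-length sp₁)))
                    (trans same-last (last-r-full n π₂ (SignedPerm-length sp₂))))
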